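{- Let $M=(y_{ij})$ be an $m\times r$ integer matrix and let $X$ be the standardized abelian Cayley graph with Heuberger matrix $M$. For each $j$ let $s_j=y_{1j}+\cdots+y_{mj}$. Suppose $s_j\neq 0$ for some $j$. If $\gcd(s_1,\dots,s_r)>1$, then $\chi(X)\le 3$.
   Context: Given an $m\times r$ integer matrix $M$, let $H$ be the subgroup of $\mathbb{Z}^m$ generated by the columns of $M$, let $e_1,\dots,e_m$ be the standard basis of $\mathbb{Z}^m$, and $S=\{H\pm e_1,\dots,H\pm e_m\}$. The standardized abelian Cayley graph with Heuberger matrix $M$ is $\mathrm{Cay}(\mathbb{Z}^m/H,S)$ (vertices $\mathbb{Z}^m/H$, $x\sim y$ iff $x-y\in S$; loops allowed, no multiple edges). $\chi$ denotes chromatic number. -}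

module Defs where

open import Data.Nat using (ℕ)
open import Data.Fin using (Fin; _≟_)
open import Data.Integer using (ℤ; +_; _+_; _-_; _*_; -_; _>_)
open import Data.Integer.GCD using (gcd)
open import Data.Product using (Σ; ∃; ∃-syntax; Σ-syntax; _×_)
open import Data.Sum using (_⊎_)
open import Data.Bool using (if_then_else_)
open import Relation.Nullary using (¬_)
open import Relation.Nullary.Decidable using (⌊_⌋)
open import Relation.Binary.PropositionalEquality using (_≡_; _≢_)

ℤ^ : ℕ → Set
ℤ^ m = Fin m → ℤ

Σℤ : ∀ {n} → (Fin n → ℤ) → ℤ
Σℤ {ℕ.zero} f = + 0
Σℤ {ℕ.suc n} f = f Fin.zero + Σℤ (λ j → f (Fin.suc j))

Matrix : ℕ → ℕ → Set
Matrix m r = Fin m → Fin r → ℤ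

_⊖_ : ∀ {m} → ℤ^ m → ℤ^ m → ℤ^ m
(x ⊖ y) i = x i - y i

e : ∀ {m} → Fin m → ℤ^ m
e i k = if ⌊ k ≟ i ⌋ then + 1 else + 0

inH : ∀ {m r} → Matrix m r → ℤ^ m → Set
inH {m} {r} M x = Σ[ a ∈ (Fin r → ℤ) ] ((i : Fin m) → x i ≡ Σℤ {r} (λ j → a j * M i j))

-- x - y ∈ S = {H ± e_1, …, H ± e_m}  (i.e. x ~ y in the Cayley graph)
Adj : ∀ {m r} → Matrix m r → ℤ^ m → ℤ^ m → Set
Adj {m} M x y = ∃[ i ] (inH M ((x ⊖ y) ⊖ e i) ⊎ inH M ((x ⊖ y) ⊖ (λ k → - e i k)))

-- a proper k-colouring of Cay(ℤ^m/H, S): a colouring of ℤ^m constant on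
-- cosets of H (i.e. a function on ℤ^m/H) with adjacent vertices (loops
-- included) receiving different colours
record ProperColouring {m r} (M : Matrix m r) (k : ℕ) : Set where
  field
    colour     : ℤ^ m → Fin k
    wellDef    : ∀ x y → inH M (x ⊖ y) → colour x ≡ colour y
    proper     : ∀ x y → Adj M x y → colour x ≢ colour y

χ≤ : ∀ {m r} → Matrix m r → ℕ → Set
χ≤ M k = ProperColouring M k

colSum : ∀ {m r} → Matrix m r → Fin r → ℤ
colSum {m} M j = Σℤ {m} (λ i → M i j)

gcdℤ : ∀ {n} → (Fin n → ℤ) → ℤ
gcdℤ {ℕ.zero} f = + 0
gcdℤ {ℕ.suc n} f = gcd (f Fin.zero) (gcdℤ (λ j → f (Fin.suc j)))

-- The map x ↦ x₁ + ⋯ + xₘ from ℤ^m to ℤ sends the j-th column of M to sⱼ, so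
-- with n = gcd(s₁, …, s_r) it induces a homomorphism ℤ^m/H → ℤ/nℤ taking
-- every generator H ± eᵢ to ±1. It is therefore a graph homomorphism from X to
-- the cycle Cay(ℤ/nℤ, {±1}), and since n ≥ 2 that cycle is 3-colourable: give
-- residue 0 the third colour and alternate the other two along 1, 2, …, n − 1.
module Submission where

open import Defs
open import Data.Nat using (ℕ)
open import Data.Fin using (Fin)
open import Data.Integer using (ℤ; +_; _>_)
open import Data.Product using (∃-syntax)
open import Relation.Binary.PropositionalEquality using (_≢_)

open import Data.Nat using (zero; suc; _<_; NonZero; >-nonZero; >-nonZero⁻¹; z<s; s<s⁻¹)
open import Data.Nat.Properties using (≤-<-trans; <-trans; ≤∧≢⇒<; ⊔-lub)
import Data.Nat.Divisibility as ℕ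
open import Data.Fin using (zero; suc)
open import Data.Fin.Patterns using (0F; 1F; 2F)
open import Data.Integer using (_+_; _-_; _*_; -_; +<+; ∣_∣; _%ℕ_; _/ℕ_)
open import Data.Integer.Properties
  using (+-identityˡ; neg-distrib-+; +-injective; m-n≡m⊖n; ∣m⊝n∣≤m⊔n; ∣i∣≡0⇒i≡0;
         +-minus-telescope; i-j≡0⇒i≡j; +-0-commutativeMonoid; +-*-semiring)
open import Data.Integer.DivMod using (a≡a%ℕn+[a/ℕn]*n; n%ℕd<d)
import Data.Integer.Divisibility as Unsigned
open import Data.Integer.Divisibility.Signed
  using (_∣_; divides; ∣ᵤ⇒∣; ∣⇒∣ᵤ; ∣-refl; ∣m∣n⇒∣m+n; ∣m∣n⇒∣m-n; ∣m⇒∣-m; ∣n⇒∣m*n)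
open import Data.Integer.GCD using (gcd[i,j]∣i; gcd[i,j]∣j)
open import Data.Integer.Tactic.RingSolver using (solve-∀)
open import Data.Product using (_,_)
open import Data.Sum using (_⊎_; inj₁; inj₂)
open import Data.Vec.Functional using (tail)
open import Algebra.Properties.CommutativeMonoid.Sum +-0-commutativeMonoid
  using (sum; sum-cong-≗; sum-replicate-zero; ∑-comm)
open import Algebra.Properties.Semiring.Sum +-*-semiring using (*-distribˡ-sum)
open import Function using (_∘_)
open import Relation.Nullary using (yes; no; contradiction)
open import Relation.Binary.PropositionalEquality using (_≡_; refl; sym; trans; cong; cong₂; subst; module ≡-Reasoning)
open ≡-Reasoning

Σℤ≡sum : ∀ {n} (f : Fin n → ℤ) → Σℤ f ≡ sum f
Σℤ≡sum {zero}  f = refl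
Σℤ≡sum {suc n} f = cong (_+_ (f zero)) (Σℤ≡sum (tail f))

Σℤ-cong : ∀ {n} {f g : Fin n → ℤ} → (∀ i → f i ≡ g i) → Σℤ f ≡ Σℤ g
Σℤ-cong {f = f} {g} f≗g = begin
  Σℤ f   ≡⟨ Σℤ≡sum f ⟩
  sum f  ≡⟨ sum-cong-≗ f≗g ⟩
  sum g  ≡⟨ Σℤ≡sum g ⟨
  Σℤ g   ∎

Σℤ-zero : ∀ n → Σℤ {n} (λ _ → + 0) ≡ + 0
Σℤ-zero n = trans (Σℤ≡sum {n} (λ _ → + 0)) (sum-replicate-zero n)

Σℤ-neg : ∀ {n} (f : Fin n → ℤ) → Σℤ (λ i → - f i) ≡ - Σℤ f
Σℤ-neg {zero}  f = refl
Σℤ-neg {suc n} f =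
  trans (cong (_+_ (- f zero)) (Σℤ-neg (tail f))) (sym (neg-distrib-+ (f zero) (Σℤ (tail f))))

Σℤ-⊖ : ∀ {n} (x y : ℤ^ n) → Σℤ (x ⊖ y) ≡ Σℤ x - Σℤ y
Σℤ-⊖ {zero}  x y = refl
Σℤ-⊖ {suc n} x y = begin
  (x₀ - y₀) + Σℤ (tail x ⊖ tail y)  ≡⟨ cong (_+_ (x₀ - y₀)) (Σℤ-⊖ (tail x) (tail y)) ⟩
  (x₀ - y₀) + (Σx′ - Σy′)            ≡⟨ [i-j]+[k-l]≡[i+k]-[j+l] x₀ y₀ Σx′ Σy′ ⟩
  (x₀ + Σx′) - (y₀ + Σy′)            ∎
  where
  [i-j]+[k-l]≡[i+k]-[j+l] : ∀ i j k l → (i - j) + (k - l) ≡ (i + k) - (j + l)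
  [i-j]+[k-l]≡[i+k]-[j+l] = solve-∀
  x₀ = x zero
  y₀ = y zero
  Σx′ = Σℤ (tail x)
  Σy′ = Σℤ (tail y)

e-suc : ∀ {m} (i j : Fin m) → e {suc m} (suc i) (suc j) ≡ e i j
e-suc i j with j Data.Fin.≟ i
... | yes _ = refl
... | no  _ = refl

Σℤ-e : ∀ {m} (i : Fin m) → Σℤ (e i) ≡ + 1
Σℤ-e {suc m} zero    = cong (_+_ (+ 1)) (Σℤ-zero m)
Σℤ-e {suc m} (suc i) = begin
  + 0 + Σℤ (λ j → e (suc i) (suc j))  ≡⟨ +-identityˡ _ ⟩
  Σℤ (λ j → e (suc i) (suc j))        ≡⟨ Σℤ-cong (e-suc i) ⟩
  Σℤ (e i)                            ≡⟨ Σℤ-e i ⟩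
  + 1                                 ∎

Σℤ-∣ : ∀ {n} {d : ℤ} (f : Fin n → ℤ) → (∀ i → d ∣ f i) → d ∣ Σℤ f
Σℤ-∣ {zero}  f d∣f = divides (+ 0) refl
Σℤ-∣ {suc n} f d∣f = ∣m∣n⇒∣m+n (d∣f zero) (Σℤ-∣ (tail f) (d∣f ∘ suc))

gcdℤ[f]∣f : ∀ {n} (f : Fin n → ℤ) (j : Fin n) → gcdℤ f Unsigned.∣ f j
gcdℤ[f]∣f f zero    = gcd[i,j]∣i (f zero) (gcdℤ (tail f))
gcdℤ[f]∣f f (suc j) = ℕ.∣-trans (gcd[i,j]∣j (f zero) (gcdℤ (tail f))) (gcdℤ[f]∣f (tail f) j)

Σℤ-columnCombination : ∀ {m r} (M : Matrix m r) (a : Fin r → ℤ) →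
  Σℤ (λ i → Σℤ (λ j → a j * M i j)) ≡ Σℤ (λ j → a j * colSum M j)
Σℤ-columnCombination M a = begin
  Σℤ (λ i → Σℤ (λ j → a j * M i j))   ≡⟨ Σℤ≡sum (λ i → Σℤ (λ j → a j * M i j)) ⟩
  sum (λ i → Σℤ (λ j → a j * M i j))  ≡⟨ sum-cong-≗ (λ i → Σℤ≡sum (λ j → a j * M i j)) ⟩
  sum (λ i → sum (λ j → a j * M i j)) ≡⟨ ∑-comm (λ i j → a j * M i j) ⟩
  sum (λ j → sum (λ i → a j * M i j)) ≡⟨ sum-cong-≗ (λ j → sym (*-distribˡ-sum (a j) (λ i → M i j))) ⟩
  sum (λ j → a j * sum (λ i → M i j)) ≡⟨ sum-cong-≗ (λ j → cong (a j *_) (sym (Σℤ≡sum (λ i → M i j)))) ⟩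
  sum (λ j → a j * colSum M j)        ≡⟨ Σℤ≡sum (λ j → a j * colSum M j) ⟨
  Σℤ (λ j → a j * colSum M j)         ∎

module _ {m r} (M : Matrix m r) {d : ℤ} (d∣s : ∀ j → d ∣ colSum M j) where

  inH⇒∣Σℤ : ∀ {z} → inH M z → d ∣ Σℤ z
  inH⇒∣Σℤ {z} (a , z≡Ma) =
    subst (d ∣_) (sym (trans (Σℤ-cong z≡Ma) (Σℤ-columnCombination M a)))
      (Σℤ-∣ _ (λ j → ∣n⇒∣m*n (a j) (d∣s j)))

  inH[x⊖y]⇒∣Σℤ : ∀ x y → inH M (x ⊖ y) → d ∣ Σℤ x - Σℤ y
  inH[x⊖y]⇒∣Σℤ x y h = subst (d ∣_) (Σℤ-⊖ x y) (inH⇒∣Σℤ h)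

  Adj⇒∣Σℤ : ∀ x y → Adj M x y → (d ∣ Σℤ x - (+ 1 + Σℤ y)) ⊎ (d ∣ Σℤ y - (+ 1 + Σℤ x))
  Adj⇒∣Σℤ x y (i , inj₁ h) = inj₁ (subst (d ∣_) Σ≡ (inH⇒∣Σℤ h))
    where
    [i-j]-1≡i-[1+j] : ∀ i j → (i - j) - + 1 ≡ i - (+ 1 + j)
    [i-j]-1≡i-[1+j] = solve-∀
    Σ≡ : Σℤ ((x ⊖ y) ⊖ e i) ≡ Σℤ x - (+ 1 + Σℤ y)
    Σ≡ = begin
      Σℤ ((x ⊖ y) ⊖ e i)           ≡⟨ Σℤ-⊖ (x ⊖ y) (e i) ⟩
      Σℤ (x ⊖ y) - Σℤ (e i)        ≡⟨ cong₂ _-_ (Σℤ-⊖ x y) (Σℤ-e i) ⟩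
      (Σℤ x - Σℤ y) - + 1          ≡⟨ [i-j]-1≡i-[1+j] (Σℤ x) (Σℤ y) ⟩
      Σℤ x - (+ 1 + Σℤ y)          ∎
  Adj⇒∣Σℤ x y (i , inj₂ h) = inj₂ (subst (d ∣_) Σ≡ (∣m⇒∣-m (inH⇒∣Σℤ h)))
    where
    -[[i-j]+1]≡j-[1+i] : ∀ i j → - ((i - j) - - + 1) ≡ j - (+ 1 + i)
    -[[i-j]+1]≡j-[1+i] = solve-∀
    Σ≡ : - Σℤ ((x ⊖ y) ⊖ (λ k → - e i k)) ≡ Σℤ y - (+ 1 + Σℤ x)
    Σ≡ = begin
      - Σℤ ((x ⊖ y) ⊖ (λ k → - e i k))          ≡⟨ cong -_ (Σℤ-⊖ (x ⊖ y) _) ⟩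
      - (Σℤ (x ⊖ y) - Σℤ (λ k → - e i k))       ≡⟨ cong (λ t → - (Σℤ (x ⊖ y) - t)) (Σℤ-neg (e i)) ⟩
      - (Σℤ (x ⊖ y) - - Σℤ (e i))               ≡⟨ cong₂ (λ s t → - (s - - t)) (Σℤ-⊖ x y) (Σℤ-e i) ⟩
      - ((Σℤ x - Σℤ y) - - + 1)                 ≡⟨ -[[i-j]+1]≡j-[1+i] (Σℤ x) (Σℤ y) ⟩
      Σℤ y - (+ 1 + Σℤ x)                       ∎

module _ (n : ℕ) .{{_ : NonZero n}} where

  n∣a-a%ℕn : ∀ a → + n ∣ a - + (a %ℕ n)
  n∣a-a%ℕn a = divides (a /ℕ n) (begin
    a - + ρ                      ≡⟨ cong (_- + ρ) (a≡a%ℕn+[a/ℕn]*n a n) ⟩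
    (+ ρ + (a /ℕ n) * + n) - + ρ ≡⟨ [i+j]-i≡j (+ ρ) ((a /ℕ n) * + n) ⟩
    (a /ℕ n) * + n               ∎)
    where
    [i+j]-i≡j : ∀ i j → (i + j) - i ≡ j
    [i+j]-i≡j = solve-∀
    ρ = a %ℕ n

  n∣i⇒∣i∣<n⇒i≡0 : ∀ {i} → + n ∣ i → ∣ i ∣ < n → i ≡ + 0
  n∣i⇒∣i∣<n⇒i≡0 {i} n∣i ∣i∣<n = ∣i∣≡0⇒i≡0 (smallMultiple (∣⇒∣ᵤ n∣i) ∣i∣<n)
    where
    smallMultiple : ∀ {k} → n ℕ.∣ k → k < n → k ≡ 0
    smallMultiple {zero}  _   _   = refl
    smallMultiple {suc k} n∣k k<n = contradiction n∣k (ℕ.>⇒∤ k<n)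

  %ℕ-unique : ∀ a {r} → r < n → + n ∣ a - + r → a %ℕ n ≡ r
  %ℕ-unique a {r} r<n n∣a-r = +-injective (i-j≡0⇒i≡j (+ ρ) (+ r) (n∣i⇒∣i∣<n⇒i≡0 n∣ρ-r ∣ρ-r∣<n))
    where
    [i-k]-[i-j]≡j-k : ∀ i j k → (i - k) - (i - j) ≡ j - k
    [i-k]-[i-j]≡j-k = solve-∀
    ρ = a %ℕ n
    n∣ρ-r : + n ∣ + ρ - + r
    n∣ρ-r = subst (+ n ∣_) ([i-k]-[i-j]≡j-k a (+ ρ) (+ r)) (∣m∣n⇒∣m-n n∣a-r (n∣a-a%ℕn a))
    ∣ρ-r∣<n : ∣ + ρ - + r ∣ < n
    ∣ρ-r∣<n = subst (_< n) (cong ∣_∣ (sym (m-n≡m⊖n ρ r)))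
      (≤-<-trans (∣m⊝n∣≤m⊔n ρ r) (⊔-lub (n%ℕd<d a n) r<n))

  %ℕ-cong : ∀ a b → + n ∣ a - b → a %ℕ n ≡ b %ℕ n
  %ℕ-cong a b n∣a-b = %ℕ-unique a (n%ℕd<d b n)
    (subst (+ n ∣_) (+-minus-telescope a b (+ (b %ℕ n))) (∣m∣n⇒∣m+n n∣a-b (n∣a-a%ℕn b)))

  %ℕ-suc : ∀ b → suc (b %ℕ n) < n → (+ 1 + b) %ℕ n ≡ suc (b %ℕ n)
  %ℕ-suc b sρ<n = %ℕ-unique (+ 1 + b) sρ<n
    (subst (+ n ∣_) ([i-j]≡[1+i]-[1+j] b (+ (b %ℕ n))) (n∣a-a%ℕn b))
    where
    [i-j]≡[1+i]-[1+j] : ∀ i j → i - j ≡ (+ 1 + i) - (+ 1 + j)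
    [i-j]≡[1+i]-[1+j] = solve-∀

  %ℕ-wrap : ∀ b → suc (b %ℕ n) ≡ n → (+ 1 + b) %ℕ n ≡ 0
  %ℕ-wrap b sρ≡n = %ℕ-unique (+ 1 + b) (>-nonZero⁻¹ n)
    (subst (+ n ∣_) Σ≡ (∣m∣n⇒∣m+n ∣-refl (n∣a-a%ℕn b)))
    where
    [1+j]+[i-j]≡[1+i]-0 : ∀ i j → + 1 + j + (i - j) ≡ (+ 1 + i) - + 0
    [1+j]+[i-j]≡[1+i]-0 = solve-∀
    ρ = b %ℕ n
    Σ≡ : + n + (b - + ρ) ≡ (+ 1 + b) - + 0
    Σ≡ = begin
      + n + (b - + ρ)        ≡⟨ cong (λ k → + k + (b - + ρ)) (sym sρ≡n) ⟩
      + 1 + + ρ + (b - + ρ)  ≡⟨ [1+j]+[i-j]≡[1+i]-0 b (+ ρ) ⟩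
      (+ 1 + b) - + 0        ∎

parity : ℕ → Fin 3
parity zero          = 0F
parity (suc zero)    = 1F
parity (suc (suc r)) = parity r

parity≢2F : ∀ r → parity r ≢ 2F
parity≢2F zero          ()
parity≢2F (suc zero)    ()
parity≢2F (suc (suc r)) = parity≢2F r

parity-suc : ∀ r → parity (suc r) ≢ parity r
parity-suc zero          ()
parity-suc (suc zero)    ()
parity-suc (suc (suc r)) = parity-suc r

residueColour : ℕ → Fin 3
residueColour zero    = 2F
residueColour (suc r) = parity r

residueColour-suc : ∀ r → residueColour (suc r) ≢ residueColour r
residueColour-suc zero    ()
residueColour-suc (suc r) = parity-suc r

residueColour-positive : ∀ {r} → 0 < r → residueColour 0 ≢ residueColour r
residueColour-positive {suc r} _ = parity≢2F r ∘ sym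

module _ (n : ℕ) .{{_ : NonZero n}} where

  colourMod : ℤ → Fin 3
  colourMod a = residueColour (a %ℕ n)

  colourMod-cong : ∀ a b → + n ∣ a - b → colourMod a ≡ colourMod b
  colourMod-cong a b = cong residueColour ∘ %ℕ-cong n a b

  colourMod-suc : 1 < n → ∀ b → colourMod (+ 1 + b) ≢ colourMod b
  colourMod-suc 1<n b with suc (b %ℕ n) Data.Nat.≟ n
  ... | no sρ≢n = subst (_≢ residueColour (b %ℕ n)) (cong residueColour (sym (%ℕ-suc n b sρ<n)))
                    (residueColour-suc (b %ℕ n))
    where sρ<n = ≤∧≢⇒< (n%ℕd<d b n) sρ≢n
  ... | yes sρ≡n = subst (_≢ residueColour (b %ℕ n)) (cong residueColour (sym (%ℕ-wrap n b sρ≡n)))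
                     (residueColour-positive (s<s⁻¹ (subst (1 <_) (sym sρ≡n) 1<n)))

sumModColouring : ∀ {m r} (M : Matrix m r) (n : ℕ) → 1 < n →
  (∀ j → + n ∣ colSum M j) → ProperColouring M 3
sumModColouring M n 1<n n∣s = record
  { colour  = colourMod n ∘ Σℤ
  ; wellDef = λ x y h → colourMod-cong n (Σℤ x) (Σℤ y) (inH[x⊖y]⇒∣Σℤ M n∣s x y h)
  ; proper  = proper
  }
  where
  instance
    n≢0 : NonZero n
    n≢0 = >-nonZero (<-trans z<s 1<n)
  proper : ∀ x y → Adj M x y → colourMod n (Σℤ x) ≢ colourMod n (Σℤ y)
  proper x y adj with Adj⇒∣Σℤ M n∣s x y adj
  ... | inj₁ n∣x-[1+y] = λ x≡y → colourMod-suc n 1<n (Σℤ y)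
                            (trans (sym (colourMod-cong n (Σℤ x) (+ 1 + Σℤ y) n∣x-[1+y])) x≡y)
  ... | inj₂ n∣y-[1+x] = λ x≡y → colourMod-suc n 1<n (Σℤ x)
                            (trans (sym (colourMod-cong n (Σℤ y) (+ 1 + Σℤ x) n∣y-[1+x])) (sym x≡y))

+1<i⇒1<∣i∣ : ∀ {i} → i > + 1 → 1 < ∣ i ∣
+1<i⇒1<∣i∣ (+<+ 1<n) = 1<n

lemma2p12 : (m r : ℕ) (M : Matrix m r) →
    (∃[ j ] (colSum M j ≢ + 0)) →
    gcdℤ (colSum M) > + 1 →
    χ≤ M 3
lemma2p12 m r M _ 1<gcd =
  sumModColouring M ∣ gcdℤ (colSum M) ∣ (+1<i⇒1<∣i∣ 1<gcd) (λ j → ∣ᵤ⇒∣ (gcdℤ[f]∣f (colSum M) j))
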